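{- Let $P$ be a partition of $T$ such that $P_i\cap bd(T)=\emptyset$. Then $P_i$ is adjacent to both other districts (i.e., for each $j\neq i$ some vertex of $P_i$ is adjacent to some vertex of $P_j$).
   Context: $G_\Delta$ is the infinite triangular lattice; $T$ is an equilateral triangular subgraph of $G_\Delta$, and $bd(T)$ is the set of vertices of $T$ adjacent in $G_\Delta$ to a vertex outside $T$. A partition of $T$ is a partition of $V(T)$ into three labelled districts $P_1,P_2,P_3$, each nonempty and simply connected (induced subgraph connected, and no cycle of $G_\Delta$ made of its vertices encloses in the plane a vertex not in it). -}

module Defs where

open import Data.Nat as ℕ using (ℕ; _%_)
open import Data.Integer as ℤ using (ℤ; +_; _+_; _-_; -_)
open import Data.Product using (Σ; _×_; _,_; proj₁; proj₂)
open import Data.Sum using (_⊎_)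
open import Data.Bool using (Bool; true; false; _∧_; _∨_)
open import Data.List using (List; []; _∷_; _++_; [_]; zip; length; filter)
open import Data.List.Relation.Unary.All using (All)
open import Data.List.Relation.Unary.Unique.Propositional using (Unique)
open import Data.List.Membership.Propositional using (_∉_)
open import Data.Fin using (Fin)
open import Relation.Binary.PropositionalEquality using (_≡_)
open import Relation.Nullary using (¬_)
open import Relation.Nullary.Decidable using (⌊_⌋)

-- The infinite triangular lattice G_Δ.
-- Vertex (x , y) ∈ ℤ² is drawn in the plane at x·(1,0) + y·(1/2, √3/2).
-- Its six neighbours are (x,y) + (±1,0), (0,±1), (1,-1), (-1,1).

Pt : Set
Pt = ℤ × ℤ

Adj : Pt → Pt → Set
Adj (x , y) (x' , y') =
    (x' ≡ x + + 1 × y' ≡ y)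
  ⊎ (x' ≡ x - + 1 × y' ≡ y)
  ⊎ (x' ≡ x × y' ≡ y + + 1)
  ⊎ (x' ≡ x × y' ≡ y - + 1)
  ⊎ (x' ≡ x + + 1 × y' ≡ y - + 1)
  ⊎ (x' ≡ x - + 1 × y' ≡ y + + 1)

-- Equilateral triangular subgraphs T of G_Δ (induced on the lattice
-- points of a lattice triangle with sides along lattice lines).
-- up  = true : { (x,y) | x ≥ a, y ≥ b, (x-a)+(y-b) ≤ n }
-- up  = false: { (x,y) | x ≤ a, y ≤ b, (a-x)+(b-y) ≤ n }

record Triangle : Set where
  constructor triangle
  field
    a  : ℤ
    b  : ℤ
    n  : ℕ
    up : Bool

InT : Triangle → Pt → Set
InT (triangle a b n true)  (x , y) = a ℤ.≤ x × b ℤ.≤ y × (x - a) + (y - b) ℤ.≤ + n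
InT (triangle a b n false) (x , y) = x ℤ.≤ a × y ℤ.≤ b × (a - x) + (b - y) ℤ.≤ + n

Bd : Triangle → Pt → Set
Bd T v = InT T v × Σ Pt (λ w → Adj v w × ¬ InT T w)

data Walk (S : Pt → Set) : Pt → Pt → Set where
  here : ∀ {u} → S u → Walk S u u
  step : ∀ {u w v} → S u → Adj u w → Walk S w v → Walk S u v

Connected : (Pt → Set) → Set
Connected S = ∀ u v → S u → S v → Walk S u v

cycEdges : List Pt → List (Pt × Pt)
cycEdges []       = []
cycEdges (v ∷ vs) = zip (v ∷ vs) (vs ++ [ v ])

IsCycle : List Pt → Set
IsCycle vs = 3 ℕ.≤ length vs × Unique vs
           × All (λ e → Adj (proj₁ e) (proj₂ e)) (cycEdges vs)

-- Point-in-polygon test (ray crossing, half-open rule) for the ray from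
-- p = (px,py) in direction +x (in the drawing, horizontal to the right).
-- An edge crosses this ray iff exactly one endpoint lies strictly above
-- the line y = py and the crossing point lies to the right of p; for
-- lattice edges (|dy| ≤ 1) the crossing point is the endpoint on y = py.
crossesRay : Pt → Pt × Pt → Bool
crossesRay (px , py) ((ux , uy) , (wx , wy)) =
    (⌊ uy ℤ.≟ py ⌋ ∧ ⌊ wy ℤ.≟ py + + 1 ⌋ ∧ ⌊ px ℤ.<? ux ⌋)
  ∨ (⌊ wy ℤ.≟ py ⌋ ∧ ⌊ uy ℤ.≟ py + + 1 ⌋ ∧ ⌊ px ℤ.<? wx ⌋)

crossings : Pt → List Pt → ℕ
crossings p vs = length (filter (λ e → Data.Bool._≟_ (crossesRay p e) true) (cycEdges vs))

Encloses : List Pt → Pt → Set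
Encloses vs p = p ∉ vs × crossings p vs % 2 ≡ 1

SimplyConnected : (Pt → Set) → Set
SimplyConnected S =
  Connected S × (∀ vs → IsCycle vs → All S vs → ∀ p → Encloses vs p → S p)

-- Partitions of T into three labelled districts, given by a labelling
-- d : Pt → Fin 3 (only its values on V(T) matter); P_j = d⁻¹(j) ∩ V(T).

District : Triangle → (Pt → Fin 3) → Fin 3 → Pt → Set
District T d j v = InT T v × d v ≡ j

IsPartition : Triangle → (Pt → Fin 3) → Set
IsPartition T d = ∀ j → Σ Pt (District T d j) × SimplyConnected (District T d j)

AdjacentSets : (Pt → Set) → (Pt → Set) → Set
AdjacentSets A B = Σ Pt λ u → Σ Pt λ v → A u × B v × Adj u v

-- Suppose P_i has no vertex adjacent to P_j. Walk around the outside of P_i keeping it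
-- on the left: the successor map on boundary darts is injective on a finite set, so the walk
-- closes up. Its vertices are neighbours of P_i outside P_i; as P_i avoids bd(T) they lie in T,
-- and they are not in P_j, so they all lie in the third district P_k. Started just right of the
-- lexicographically highest point p of P_i, the walk crosses the horizontal ray from p exactly
-- once; cutting it at repeated vertices leaves a cycle in P_k that still encloses p. Simple
-- connectivity of P_k then gives p ∈ P_k, a contradiction. Adjacency of two districts is
-- decidable since T is finite, so refuting non-adjacency proves adjacency.

module Submission where

open import Defs
open import Data.Bool as Bool using (Bool; true; false; if_then_else_; _∧_; _∨_)
import Data.Bool.Properties as Bool
open import Data.Empty using (⊥-elim)
open import Data.Fin as Fin using (Fin; toℕ)
open import Data.Fin.Patterns using (0F; 1F; 2F; 3F; 4F; 5F)
import Data.Fin.Properties as Fin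
open import Data.Integer as ℤ using (ℤ; +_; _+_; _-_; ∣_∣)
import Data.Integer.Properties as ℤ
open import Data.Integer.Tactic.RingSolver using (solve-∀)
open import Data.List
  using (List; []; _∷_; _++_; [_]; zip; length; filter; lookup; applyUpTo; allFin; cartesianProduct; cartesianProductWith)
open import Data.List.Properties
  using (++-assoc; length-++; filter-++; filter-accept; filter-none; applyUpTo-∷ʳ)
open import Data.List.Membership.Propositional using (_∈_; lose)
open import Data.List.Membership.Propositional.Properties
  using (∈-∃++; ∈-filter⁺; ∈-cartesianProduct⁺; ∈-cartesianProductWith⁺; ∈-allFin; ∈-++⁺ˡ; ∈-++⁺ʳ; ∈-applyUpTo⁺)
open import Data.List.Relation.Unary.All as All using (All; []; _∷_)
import Data.List.Relation.Unary.All.Properties as All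
open import Data.List.Relation.Unary.All.Properties.Core using (¬Any⇒All¬)
open import Data.List.Relation.Unary.Any using (index; any?; satisfied)
open import Data.List.Relation.Unary.Any.Properties using (lookup-index)
open import Data.List.Relation.Unary.Unique.Propositional using (Unique; []; _∷_)
open import Data.Nat as ℕ using (ℕ; zero; suc; _∸_; _%_; _<_; z≤n; s≤s)
import Data.Nat.Properties as ℕ
open import Algebra.Properties.CommutativeSemigroup ℕ.+-commutativeSemigroup using (x∙yz≈y∙xz)
open import Data.Nat.DivMod using (%-distribˡ-+; m%n<n)
open import Data.Nat.Induction using (<-wellFounded)
open import Data.Product using (Σ; ∃-syntax; _×_; _,_; proj₁; proj₂)
import Data.Product.Properties as Product
open import Data.Product.Relation.Binary.Lex.NonStrict using (×-totalOrder)
open import Data.Sum as Sum using (_⊎_; inj₁; inj₂)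
open import Function using (_∘_; case_of_)
open import Function.Bundles using (module Equivalence)
open import Induction.WellFounded using (Acc; acc)
open import Relation.Binary.Bundles using (TotalOrder)
open import Relation.Binary.Definitions using (DecidableEquality)
open import Relation.Binary.PropositionalEquality hiding ([_])
open import Relation.Nullary using (Dec; yes; no; ¬_)
open import Relation.Nullary.Decidable using (⌊_⌋; _×-dec_; toWitness; fromWitness; decidable-stable)
open import Relation.Unary using (Decidable)

[i+1]-1≡i : ∀ i → (i + + 1) - + 1 ≡ i
[i+1]-1≡i = solve-∀

[i-1]+1≡i : ∀ i → (i - + 1) + + 1 ≡ i
[i-1]+1≡i = solve-∀

i<i+1 : ∀ i → i ℤ.< i + + 1
i<i+1 i = ℤ.suc[i]≤j⇒i<j (ℤ.≤-reflexive (ℤ.+-comm (+ 1) i))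

i-1<i : ∀ i → i - + 1 ℤ.< i
i-1<i i = subst (i - + 1 ℤ.<_) ([i-1]+1≡i i) (i<i+1 (i - + 1))

i+1+1≢i : ∀ i → (i + + 1) + + 1 ≢ i
i+1+1≢i i e = ℤ.<-irrefl (sym e) (ℤ.<-trans (i<i+1 i) (i<i+1 (i + + 1)))

i-1≢i+1 : ∀ i → i - + 1 ≢ i + + 1
i-1≢i+1 i = ℤ.<⇒≢ (ℤ.<-trans (i-1<i i) (i<i+1 i))

i-1≤j<i⇒i≡j+1 : ∀ {i j} → i - + 1 ℤ.≤ j → j ℤ.< i → i ≡ j + + 1
i-1≤j<i⇒i≡j+1 {i} {j} i-1≤j j<i = ℤ.≤-antisym
  (subst (ℤ._≤ j + + 1) ([i-1]+1≡i i) (ℤ.+-monoˡ-≤ (+ 1) i-1≤j))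
  (subst (ℤ._≤ i) (ℤ.+-comm (+ 1) j) (ℤ.i<j⇒suc[i]≤j j<i))

i≤i+j : ∀ {i j} → + 0 ℤ.≤ j → i ℤ.≤ i + j
i≤i+j {i} {j} 0≤j = subst (ℤ._≤ i + j) (ℤ.+-identityʳ i) (ℤ.+-monoʳ-≤ i 0≤j)

i≤j+i : ∀ {i j} → + 0 ℤ.≤ j → i ℤ.≤ j + i
i≤j+i {i} {j} 0≤j = subst (ℤ._≤ j + i) (ℤ.+-identityˡ i) (ℤ.+-monoˡ-≤ i 0≤j)

Dir : Set
Dir = Fin 6

-- Direction k points at angle 60°·k in the drawing of Defs.
move : Pt → Dir → Pt
move (x , y) 0F = (x + + 1 , y)
move (x , y) 1F = (x , y + + 1)
move (x , y) 2F = (x - + 1 , y + + 1)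
move (x , y) 3F = (x - + 1 , y)
move (x , y) 4F = (x , y - + 1)
move (x , y) 5F = (x + + 1 , y - + 1)

move-adj : ∀ u k → Adj u (move u k)
move-adj _ 0F = inj₁ (refl , refl)
move-adj _ 3F = inj₂ (inj₁ (refl , refl))
move-adj _ 1F = inj₂ (inj₂ (inj₁ (refl , refl)))
move-adj _ 4F = inj₂ (inj₂ (inj₂ (inj₁ (refl , refl))))
move-adj _ 5F = inj₂ (inj₂ (inj₂ (inj₂ (inj₁ (refl , refl)))))
move-adj _ 2F = inj₂ (inj₂ (inj₂ (inj₂ (inj₂ (refl , refl)))))

adj⇒move : ∀ {u v} → Adj u v → Σ Dir λ k → v ≡ move u k
adj⇒move (inj₁ (refl , refl))                                   = 0F , refl
adj⇒move (inj₂ (inj₁ (refl , refl)))                            = 3F , refl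
adj⇒move (inj₂ (inj₂ (inj₁ (refl , refl))))                     = 1F , refl
adj⇒move (inj₂ (inj₂ (inj₂ (inj₁ (refl , refl)))))              = 4F , refl
adj⇒move (inj₂ (inj₂ (inj₂ (inj₂ (inj₁ (refl , refl))))))       = 5F , refl
adj⇒move (inj₂ (inj₂ (inj₂ (inj₂ (inj₂ (refl , refl))))))       = 2F , refl

turn : Dir → Dir
turn 0F = 1F
turn 1F = 2F
turn 2F = 3F
turn 3F = 4F
turn 4F = 5F
turn 5F = 0F

rot : ℕ → Dir → Dir
rot zero    k = k
rot (suc n) k = turn (rot n k)

rot-6 : ∀ k → rot 6 k ≡ k
rot-6 0F = refl
rot-6 1F = refl
rot-6 2F = refl
rot-6 3F = refl
rot-6 4F = refl
rot-6 5F = refl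

move-back : ∀ u k → move (move u k) (rot 3 k) ≡ u
move-back (x , y) 0F = cong (_, y) ([i+1]-1≡i x)
move-back (x , y) 1F = cong (x ,_) ([i+1]-1≡i y)
move-back (x , y) 2F = cong₂ _,_ ([i-1]+1≡i x) ([i+1]-1≡i y)
move-back (x , y) 3F = cong (_, y) ([i-1]+1≡i x)
move-back (x , y) 4F = cong (x ,_) ([i-1]+1≡i y)
move-back (x , y) 5F = cong₂ _,_ ([i+1]-1≡i x) ([i-1]+1≡i y)

-- u, move u k and move u (rot 1 k) form a unit triangle, as do u, move u k and move u (rot 5 k).
move-left : ∀ u k → move (move u k) (rot 2 k) ≡ move u (rot 1 k)
move-left (x , y) 0F = cong (_, y + + 1) ([i+1]-1≡i x)
move-left (x , y) 1F = refl
move-left (x , y) 2F = cong (x - + 1 ,_) ([i+1]-1≡i y)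
move-left (x , y) 3F = cong (_, y - + 1) ([i-1]+1≡i x)
move-left (x , y) 4F = refl
move-left (x , y) 5F = cong (x + + 1 ,_) ([i-1]+1≡i y)

move-right : ∀ u k → move (move u k) (rot 4 k) ≡ move u (rot 5 k)
move-right (x , y) 0F = refl
move-right (x , y) 1F = cong (x + + 1 ,_) ([i+1]-1≡i y)
move-right (x , y) 2F = cong (_, y + + 1) ([i-1]+1≡i x)
move-right (x , y) 3F = refl
move-right (x , y) 4F = cong (x - + 1 ,_) ([i-1]+1≡i y)
move-right (x , y) 5F = cong (_, y - + 1) ([i+1]-1≡i x)

move-adj⁻ : ∀ u k → Adj (move u k) u
move-adj⁻ u k = subst (Adj (move u k)) (move-back u k) (move-adj (move u k) (rot 3 k))

-- Tracing the outer boundary of a set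

-- The left-hand rule: arriving at a vertex along direction k with neighbourhood pattern N, where
-- N (rot 2 k) holds and N (rot 3 k), N (rot 4 k) do not, leave along the first direction m,
-- scanning counterclockwise from rot 4 k, whose left-hand neighbour rot 1 m satisfies N.
-- backDir recovers the way back, rot 3 k, by the mirror-image scan.
nextDir : (Dir → Bool) → Dir → Dir
nextDir N k =
  if N (rot 5 k) then rot 4 k else if N k then rot 5 k
  else if N (rot 1 k) then k else rot 1 k

backDir : (Dir → Bool) → Dir → Dir
backDir N m =
  if N (rot 4 m) then rot 5 m else if N (rot 3 m) then rot 4 m
  else if N (rot 2 m) then rot 3 m else rot 2 m

private
  N-rot-6 : ∀ (N : Dir → Bool) r k {b} → N (rot r k) ≡ b → N (rot 6 (rot r k)) ≡ b
  N-rot-6 N r k = trans (cong N (rot-6 (rot r k)))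

nextDir-spec : ∀ N k → N (rot 2 k) ≡ true → N (rot 3 k) ≡ false → N (rot 4 k) ≡ false →
               let m = nextDir N k in
               N (rot 1 m) ≡ true × N m ≡ false × N (rot 5 m) ≡ false × backDir N m ≡ rot 3 k
nextDir-spec N k n2 n3 n4 with N (rot 5 k) in n5
... | true rewrite N-rot-6 N 2 k n2 = n5 , n4 , N-rot-6 N 3 k n3 , rot-6 (rot 3 k)
... | false with N k in n0
...   | true rewrite N-rot-6 N 3 k n3 | N-rot-6 N 2 k n2 =
  N-rot-6 N 0 k n0 , n5 , N-rot-6 N 4 k n4 , rot-6 (rot 3 k)
...   | false with N (rot 1 k) in n1
...     | true  rewrite n4 | n3 | n2 = n1 , n0 , n5 , refl
...     | false rewrite n5 | n4 | n3 = n2 , n1 , N-rot-6 N 0 k n0 , refl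

Dart : Set
Dart = Pt × Dir

-- The edge u → move u k runs along the outside of S, with S on its left.
IsBoundaryDart : (Pt → Bool) → Dart → Set
IsBoundaryDart S (u , k) =
  S (move u (rot 1 k)) ≡ true × S u ≡ false × S (move u k) ≡ false × S (move u (rot 5 k)) ≡ false

module BoundaryTracing (S : Pt → Bool) where

  neighbourhood : Pt → Dir → Bool
  neighbourhood w j = S (move w j)

  next : Dart → Dart
  next (u , k) = let w = move u k in w , nextDir (neighbourhood w) k

  previous : Dart → Dart
  previous (w , m) = let j = backDir (neighbourhood w) m in move w j , rot 3 j

  next-spec : ∀ {d} → IsBoundaryDart S d → IsBoundaryDart S (next d) × previous (next d) ≡ d
  next-spec {u , k} (left , tail , head , right)
    with nextDir-spec (neighbourhood (move u k)) k
           (trans (cong S (move-left u k)) left)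
           (trans (cong S (move-back u k)) tail)
           (trans (cong S (move-right u k)) right)
  ... | left′ , head′ , right′ , back =
    (left′ , head , head′ , right′) ,
    cong₂ _,_ (trans (cong (move (move u k)) back) (move-back u k)) (trans (cong (rot 3) back) (rot-6 k))

-- Orbits of an injection on a finite set

orbit : {A : Set} → (A → A) → A → ℕ → A
orbit f a zero    = a
orbit f a (suc n) = f (orbit f a n)

least : ∀ {P : ℕ → Set} → Decidable P → ∀ {n} → P n → ∃[ m ] P m × (∀ {t} → t < m → ¬ P t)
least P? {zero} p = 0 , p , λ ()
least P? {suc n} p with P? 0
... | yes p₀ = 0 , p₀ , λ ()
... | no ¬p₀ with m , pm , below ← least (P? ∘ suc) p =
  suc m , pm , λ { {zero} _ → ¬p₀ ; {suc t} (s≤s t<m) → below t<m }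

module _ {A : Set} (f : A → A) (B : A → Set) (B-closed : ∀ {a} → B a → B (f a))
         (f-injective : ∀ {a b} → B a → B b → f a ≡ f b → a ≡ b) {a : A} (Ba : B a) where

  orbit-closed : ∀ n → B (orbit f a n)
  orbit-closed zero    = Ba
  orbit-closed (suc n) = B-closed (orbit-closed n)

  orbit-cancel : ∀ m n → orbit f a m ≡ orbit f a (m ℕ.+ n) → a ≡ orbit f a n
  orbit-cancel zero    n eq = eq
  orbit-cancel (suc m) n eq =
    orbit-cancel m n (f-injective (orbit-closed m) (orbit-closed (m ℕ.+ n)) eq)

  -- Pigeonhole: among the first 1 + length L points of the orbit two coincide.
  orbit-returns : (L : List A) → (∀ {b} → B b → b ∈ L) → ∃[ c ] orbit f a (suc c) ≡ a
  orbit-returns L B⊆L = return (Fin.pigeonhole (ℕ.n<1+n (length L)) position)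
    where
    open ≡-Reasoning
    ∈L : (t : Fin (suc (length L))) → orbit f a (toℕ t) ∈ L
    ∈L t = B⊆L (orbit-closed (toℕ t))
    position : Fin (suc (length L)) → Fin (length L)
    position t = index (∈L t)
    return : (∃[ i ] ∃[ j ] i Fin.< j × position i ≡ position j) → ∃[ c ] orbit f a (suc c) ≡ a
    return (i , j , i<j , same) = c , sym (orbit-cancel (toℕ i) (suc c) (begin
      orbit f a (toℕ i)                   ≡⟨ lookup-index (∈L i) ⟩
      lookup L (position i)               ≡⟨ cong (lookup L) same ⟩
      lookup L (position j)               ≡⟨ lookup-index (∈L j) ⟨
      orbit f a (toℕ j)                   ≡⟨ cong (orbit f a) (ℕ.m+[n∸m]≡n i<j) ⟨
      orbit f a (suc (toℕ i) ℕ.+ c)         ≡⟨ cong (orbit f a) (ℕ.+-suc (toℕ i) c) ⟨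
      orbit f a (toℕ i ℕ.+ suc c)           ∎))
      where
      c : ℕ
      c = toℕ j ∸ suc (toℕ i)

  orbit-firstReturn : DecidableEquality A → (L : List A) → (∀ {b} → B b → b ∈ L) →
                      ∃[ m ] orbit f a (suc m) ≡ a × (∀ {t} → t < m → orbit f a (suc t) ≢ a)
  orbit-firstReturn _≟_ L B⊆L with c , returns ← orbit-returns L B⊆L =
    least (λ t → orbit f a (suc t) ≟ a) {c} returns

-- Ray crossings and enclosing cycles

private
  witness³ : ∀ {A B C : Set} (a? : Dec A) (b? : Dec B) (c? : Dec C) →
             ⌊ a? ⌋ ∧ ⌊ b? ⌋ ∧ ⌊ c? ⌋ ≡ true → A × B × C
  witness³ (yes a) (yes b) (yes c) _ = a , b , c
  witness³ (yes _) (yes _) (no _)  ()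
  witness³ (yes _) (no _)  _       ()
  witness³ (no _)  _       _       ()

  ∨-true : ∀ x {y} → x ∨ y ≡ true → x ≡ true ⊎ y ≡ true
  ∨-true true  _ = inj₁ refl
  ∨-true false t = inj₂ t

crossesRay⇒ : ∀ {p u w} → crossesRay p (u , w) ≡ true →
  (proj₂ u ≡ proj₂ p × proj₂ w ≡ proj₂ p + + 1 × proj₁ p ℤ.< proj₁ u)
  ⊎ (proj₂ w ≡ proj₂ p × proj₂ u ≡ proj₂ p + + 1 × proj₁ p ℤ.< proj₁ w)
crossesRay⇒ {px , py} {ux , uy} {wx , wy} c =
  Sum.map (witness³ (uy ℤ.≟ py) (wy ℤ.≟ py + + 1) (px ℤ.<? ux))
          (witness³ (wy ℤ.≟ py) (uy ℤ.≟ py + + 1) (px ℤ.<? wx)) (∨-true _ c)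

crossesRay⇐ : ∀ {p u w} → proj₂ u ≡ proj₂ p → proj₂ w ≡ proj₂ p + + 1 → proj₁ p ℤ.< proj₁ u →
              crossesRay p (u , w) ≡ true
crossesRay⇐ {px , py} {ux , uy} {wx , wy} a b c with uy ℤ.≟ py | wy ℤ.≟ py + + 1 | px ℤ.<? ux
... | yes _  | yes _  | yes _  = refl
... | no ¬a  | _      | _      = ⊥-elim (¬a a)
... | yes _  | no ¬b  | _      = ⊥-elim (¬b b)
... | yes _  | yes _  | no ¬c  = ⊥-elim (¬c c)

_≟ᴾ_ : DecidableEquality Pt
_≟ᴾ_ = Product.≡-dec ℤ._≟_ ℤ._≟_

open import Data.List.Membership.DecPropositional _≟ᴾ_ using (_∈?_)

ClosedEdges : List (Pt × Pt) → Set
ClosedEdges = All (λ e → Adj (proj₁ e) (proj₂ e))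

ClosedWalk : List Pt → Set
ClosedWalk ws = ClosedEdges (cycEdges ws)

rayCrossings : Pt → List (Pt × Pt) → ℕ
rayCrossings p es = length (filter (λ e → crossesRay p e Bool.≟ true) es)

rayCrossings-++ : ∀ p es fs → rayCrossings p (es ++ fs) ≡ rayCrossings p es ℕ.+ rayCrossings p fs
rayCrossings-++ p es fs =
  trans (cong length (filter-++ (λ e → crossesRay p e Bool.≟ true) es fs)) (length-++ (filter _ es))

crossesRay-loop : ∀ p u → crossesRay p (u , u) ≡ false
crossesRay-loop (px , py) (ux , uy) with uy ℤ.≟ py | uy ℤ.≟ py + + 1
... | yes refl | yes eq = ⊥-elim (ℤ.<⇒≢ (i<i+1 py) eq)
... | yes _    | no _   = refl
... | no _     | _      = refl

crossesRay-sym : ∀ p u w → crossesRay p (w , u) ≡ crossesRay p (u , w)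
crossesRay-sym (px , py) (ux , uy) (wx , wy) =
  Bool.∨-comm (⌊ wy ℤ.≟ py ⌋ ∧ ⌊ uy ℤ.≟ py + + 1 ⌋ ∧ ⌊ px ℤ.<? wx ⌋) _

short-walk-even : ∀ p ws → ¬ 3 ℕ.≤ length ws → crossings p ws % 2 ≢ 1
short-walk-even p []           _ ()
short-walk-even p (h ∷ [])     _ rewrite crossesRay-loop p h = λ ()
short-walk-even p (h ∷ h′ ∷ []) _ with crossesRay p (h , h′) in c
... | true  rewrite crossesRay-sym p h h′ | c = λ ()
... | false rewrite crossesRay-sym p h h′ | c = λ ()
short-walk-even p (_ ∷ _ ∷ _ ∷ _) short = ⊥-elim (short (s≤s (s≤s (s≤s z≤n))))

odd-+ : ∀ m n → (m ℕ.+ n) % 2 ≡ 1 → m % 2 ≡ 1 ⊎ n % 2 ≡ 1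
odd-+ m n odd =
  digits (m % 2) (n % 2) (m%n<n m 2) (m%n<n n 2) (trans (sym (%-distribˡ-+ m n 2)) odd)
  where
  digits : ∀ a b → a < 2 → b < 2 → (a ℕ.+ b) % 2 ≡ 1 → a ≡ 1 ⊎ b ≡ 1
  digits 1 _ _ _ _ = inj₁ refl
  digits 0 1 _ _ _ = inj₂ refl
  digits 0 0 _ _ ()
  digits (suc (suc _)) _ (s≤s (s≤s ())) _
  digits 0 (suc (suc _)) _ (s≤s (s≤s ()))

odd-split : ∀ p E₁ L E₃ → rayCrossings p (E₁ ++ L ++ E₃) % 2 ≡ 1 →
            rayCrossings p L % 2 ≡ 1 ⊎ rayCrossings p (E₁ ++ E₃) % 2 ≡ 1
odd-split p E₁ L E₃ odd = Sum.map₂ (subst Odd (sym (rayCrossings-++ p E₁ E₃)))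
  (odd-+ (# L) (# E₁ ℕ.+ # E₃) (subst Odd (begin
    # (E₁ ++ L ++ E₃)        ≡⟨ rayCrossings-++ p E₁ (L ++ E₃) ⟩
    # E₁ ℕ.+ # (L ++ E₃)     ≡⟨ cong (# E₁ ℕ.+_) (rayCrossings-++ p L E₃) ⟩
    # E₁ ℕ.+ (# L ℕ.+ # E₃)  ≡⟨ x∙yz≈y∙xz (# E₁) (# L) (# E₃) ⟩
    # L ℕ.+ (# E₁ ℕ.+ # E₃)  ∎) odd))
  where
  open ≡-Reasoning
  Odd : ℕ → Set
  Odd n = n % 2 ≡ 1
  # : List (Pt × Pt) → ℕ
  # = rayCrossings p

path : List Pt → List (Pt × Pt)
path []           = []
path (_ ∷ [])     = []
path (u ∷ w ∷ ws) = (u , w) ∷ path (w ∷ ws)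

cycEdges-path : ∀ h t → cycEdges (h ∷ t) ≡ path (h ∷ t ++ [ h ])
cycEdges-path h t = go h t
  where
  go : ∀ u t → zip (u ∷ t) (t ++ [ h ]) ≡ path (u ∷ t ++ [ h ])
  go u []      = refl
  go u (w ∷ t) = cong ((u , w) ∷_) (go w t)

path-++ : ∀ A x M → path (A ++ x ∷ M) ≡ path (A ++ [ x ]) ++ path (x ∷ M)
path-++ []          x M = refl
path-++ (a ∷ [])    x M = refl
path-++ (a ∷ b ∷ A) x M = cong ((a , b) ∷_) (path-++ (b ∷ A) x M)

cycEdges-split : ∀ A x B C → ∃[ E₁ ] ∃[ E₃ ]
  cycEdges (A ++ x ∷ B ++ x ∷ C) ≡ E₁ ++ cycEdges (x ∷ B) ++ E₃ × cycEdges (A ++ x ∷ C) ≡ E₁ ++ E₃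
cycEdges-split [] x B C = [] , cycEdges (x ∷ C) , (begin
  cycEdges (x ∷ B ++ x ∷ C)                    ≡⟨ cycEdges-path x (B ++ x ∷ C) ⟩
  path (x ∷ (B ++ x ∷ C) ++ [ x ])             ≡⟨ cong (λ t → path (x ∷ t)) (++-assoc B (x ∷ C) [ x ]) ⟩
  path ((x ∷ B) ++ x ∷ C ++ [ x ])             ≡⟨ path-++ (x ∷ B) x (C ++ [ x ]) ⟩
  path (x ∷ B ++ [ x ]) ++ path (x ∷ C ++ [ x ]) ≡⟨ cong₂ _++_ (cycEdges-path x B) (cycEdges-path x C) ⟨
  cycEdges (x ∷ B) ++ cycEdges (x ∷ C)         ∎) , refl
  where open ≡-Reasoning
cycEdges-split (a ∷ A) x B C = path (a ∷ A ++ [ x ]) , path (x ∷ C ++ [ a ]) , (begin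
  cycEdges (a ∷ A ++ x ∷ B ++ x ∷ C)                  ≡⟨ cycEdges-path a (A ++ x ∷ B ++ x ∷ C) ⟩
  path (a ∷ (A ++ x ∷ B ++ x ∷ C) ++ [ a ])           ≡⟨ cong (λ t → path (a ∷ t)) (++-assoc A _ [ a ]) ⟩
  path ((a ∷ A) ++ x ∷ (B ++ x ∷ C) ++ [ a ])         ≡⟨ path-++ (a ∷ A) x _ ⟩
  path (a ∷ A ++ [ x ]) ++ path (x ∷ (B ++ x ∷ C) ++ [ a ])
    ≡⟨ cong (λ t → path (a ∷ A ++ [ x ]) ++ path (x ∷ t)) (++-assoc B (x ∷ C) [ a ]) ⟩
  path (a ∷ A ++ [ x ]) ++ path ((x ∷ B) ++ x ∷ C ++ [ a ])
    ≡⟨ cong (path (a ∷ A ++ [ x ]) ++_) (path-++ (x ∷ B) x (C ++ [ a ])) ⟩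
  path (a ∷ A ++ [ x ]) ++ path (x ∷ B ++ [ x ]) ++ path (x ∷ C ++ [ a ])
    ≡⟨ cong (λ E → path (a ∷ A ++ [ x ]) ++ E ++ path (x ∷ C ++ [ a ])) (cycEdges-path x B) ⟨
  path (a ∷ A ++ [ x ]) ++ cycEdges (x ∷ B) ++ path (x ∷ C ++ [ a ]) ∎) , (begin
  cycEdges (a ∷ A ++ x ∷ C)                           ≡⟨ cycEdges-path a (A ++ x ∷ C) ⟩
  path (a ∷ (A ++ x ∷ C) ++ [ a ])
    ≡⟨ cong (λ t → path (a ∷ t)) (++-assoc A (x ∷ C) [ a ]) ⟩
  path ((a ∷ A) ++ x ∷ C ++ [ a ])                    ≡⟨ path-++ (a ∷ A) x (C ++ [ a ]) ⟩
  path (a ∷ A ++ [ x ]) ++ path (x ∷ C ++ [ a ])      ∎)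
  where open ≡-Reasoning

unique⊎repeat : ∀ (ws : List Pt) → Unique ws ⊎ ∃[ A ] ∃[ x ] ∃[ B ] ∃[ C ] ws ≡ A ++ x ∷ B ++ x ∷ C
unique⊎repeat []       = inj₁ []
unique⊎repeat (w ∷ ws) with w ∈? ws
... | yes w∈ws with B , C , refl ← ∈-∃++ w∈ws = inj₂ ([] , w , B , C , refl)
... | no w∉ws with unique⊎repeat ws
...   | inj₁ u = inj₁ (¬Any⇒All¬ ws w∉ws ∷ u)
...   | inj₂ (A , x , B , C , refl) = inj₂ (w ∷ A , x , B , C , refl)

length-loop< : ∀ A (x : Pt) B C → length (x ∷ B) < length (A ++ x ∷ B ++ x ∷ C)
length-loop< []      x B C =
  s≤s (subst (length B <_) (sym (length-++ B)) (ℕ.m<m+n (length B) (s≤s z≤n)))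
length-loop< (a ∷ A) x B C = ℕ.m<n⇒m<1+n (length-loop< A x B C)

length-shortcut< : ∀ A (x : Pt) B C → length (A ++ x ∷ C) < length (A ++ x ∷ B ++ x ∷ C)
length-shortcut< []      x B C =
  s≤s (subst (length C <_) (sym (length-++ B)) (ℕ.m≤n+m (suc (length C)) (length B)))
length-shortcut< (a ∷ A) x B C = s≤s (length-shortcut< A x B C)

module _ (R : Pt → Set) {p : Pt} (p∉R : ¬ R p) where

  EnclosingCycle : Set
  EnclosingCycle = Σ (List Pt) λ vs → IsCycle vs × All R vs × Encloses vs p

  -- Cut the walk at a repeated vertex: one of the two closed walks so obtained is still odd.
  oddWalk⇒enclosingCycle : ∀ ws → All R ws → ClosedWalk ws → crossings p ws % 2 ≡ 1 → EnclosingCycle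
  oddWalk⇒enclosingCycle ws = go ws (<-wellFounded (length ws))
    where
    go : ∀ ws → Acc _<_ (length ws) → All R ws → ClosedWalk ws → crossings p ws % 2 ≡ 1 → EnclosingCycle
    go ws _ Rws walk odd with unique⊎repeat ws
    ... | inj₁ unique with 3 ℕ.≤? length ws
    ...   | yes long = ws , (long , unique , walk) , Rws , (λ p∈ws → p∉R (All.lookup Rws p∈ws)) , odd
    ...   | no short = ⊥-elim (short-walk-even p ws short odd)
    go _ (acc shorter) Rws walk odd | inj₂ (A , x , B , C , refl)
      with E₁ , E₃ , split , shortcut ← cycEdges-split A x B C
         | RA , Rx ∷ RBxC ← All.++⁻ A Rws
      with RB , RxC ← All.++⁻ B RBxC
         | walk₁ , walk₂₃ ← All.++⁻ E₁ (subst ClosedEdges split walk)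
      with walk₂ , walk₃ ← All.++⁻ (cycEdges (x ∷ B)) walk₂₃
      with odd-split p E₁ (cycEdges (x ∷ B)) E₃ (subst (λ E → rayCrossings p E % 2 ≡ 1) split odd)
    ... | inj₁ oddLoop = go (x ∷ B) (shorter (length-loop< A x B C)) (Rx ∷ RB) walk₂ oddLoop
    ... | inj₂ oddRest = go (A ++ x ∷ C) (shorter (length-shortcut< A x B C)) (All.++⁺ RA RxC)
            (subst ClosedEdges (sym shortcut) (All.++⁺ walk₁ walk₃))
            (subst (λ E → rayCrossings p E % 2 ≡ 1) (sym shortcut) oddRest)

-- A walk winding once around the highest point

record IsHighest (S : Pt → Bool) (t : Pt) : Set where
  field
    member        : S t ≡ true
    nothing-above : ∀ {x y} → proj₂ t ℤ.< y → S (x , y) ≡ false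
    nothing-right : ∀ {x} → proj₁ t ℤ.< x → S (x , proj₂ t) ≡ false

highest : ∀ (S : Pt → Bool) (L : List Pt) → (∀ {v} → S v ≡ true → v ∈ L) →
          ∀ {s₀} → S s₀ ≡ true → Σ Pt (IsHighest S)
highest S L S⊆L {s₀} Ss₀ = top , record
  { member        = argmax-all key Ss₀ (All.all-filter S? L)
  ; nothing-above = λ top<y → Bool.¬-not λ Sv → case ≤-top Sv of λ where
      (inj₁ (y≤ , _))   → ℤ.<⇒≱ top<y y≤
      (inj₂ (refl , _)) → ℤ.<-irrefl refl top<y
  ; nothing-right = λ top<x → Bool.¬-not λ Sv → case ≤-top Sv of λ where
      (inj₁ (_ , y≢y)) → y≢y refl
      (inj₂ (_ , x≤))  → ℤ.<⇒≱ top<x x≤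
  }
  where
  open TotalOrder (×-totalOrder ℤ.≤-decTotalOrder ℤ.≤-totalOrder) using (_≤_)
  open import Data.List.Extrema (×-totalOrder ℤ.≤-decTotalOrder ℤ.≤-totalOrder)
    using (argmax; f[xs]≤f[argmax]; argmax-all)
  key : Pt → ℤ × ℤ
  key (x , y) = y , x
  S? : ∀ v → Dec (S v ≡ true)
  S? v = S v Bool.≟ true
  top : Pt
  top = argmax key s₀ (filter S? L)
  ≤-top : ∀ {v} → S v ≡ true → key v ≤ key top
  ≤-top Sv = All.lookup (f[xs]≤f[argmax] s₀ (filter S? L)) (∈-filter⁺ S? (S⊆L Sv) Sv)

zip-applyUpTo : ∀ {A B : Set} (f : ℕ → A) (g : ℕ → B) n →
                zip (applyUpTo f n) (applyUpTo g n) ≡ applyUpTo (λ t → f t , g t) n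
zip-applyUpTo f g zero    = refl
zip-applyUpTo f g (suc n) = cong ((f 0 , g 0) ∷_) (zip-applyUpTo (f ∘ suc) (g ∘ suc) n)

module Tracing (S : Pt → Bool) (L : List Pt) (S⊆L : ∀ {v} → S v ≡ true → v ∈ L)
               (top : Pt) (top-highest : IsHighest S top) where

  open IsHighest top-highest
  open BoundaryTracing S

  private
    px py : ℤ
    px = proj₁ top
    py = proj₂ top

  start : Dart
  start = move top 0F , 2F

  start-boundary : IsBoundaryDart S start
  start-boundary = trans (cong S (move-back top 0F)) member
                 , nothing-right (i<i+1 px) , nothing-above (i<i+1 py) , nothing-above (i<i+1 py)

  -- Every point of the ray from top to the right, and every point above it, lies outside S;
  -- so a boundary edge of S can cross that ray only just right of top.
  crossing⇒start : ∀ {u k} → IsBoundaryDart S (u , k) → crossesRay top (u , move u k) ≡ true →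
                   (u , k) ≡ start
  crossing⇒start {ux , uy} {0F} _ c with crossesRay⇒ {p = top} {u = ux , uy} c
  ... | inj₁ (refl , e , _) = ⊥-elim (ℤ.<⇒≢ (i<i+1 py) e)
  ... | inj₂ (e , refl , _) = ⊥-elim (ℤ.<⇒≢ (i<i+1 py) (sym e))
  crossing⇒start {ux , uy} {1F} (left , _) c with crossesRay⇒ {p = top} {u = ux , uy} c
  ... | inj₁ (refl , _ , _) = ⊥-elim (Bool.not-¬ left (nothing-above (i<i+1 py)))
  ... | inj₂ (e , refl , _) = ⊥-elim (i+1+1≢i py e)
  crossing⇒start {ux , uy} {2F} (left , _) c with crossesRay⇒ {p = top} {u = ux , uy} c
  ... | inj₂ (e , refl , _) = ⊥-elim (i+1+1≢i py e)
  ... | inj₁ (refl , _ , px<ux) with px ℤ.<? ux - + 1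
  ...   | yes px<ux-1 = ⊥-elim (Bool.not-¬ left (nothing-right px<ux-1))
  ...   | no  px≮ux-1 = cong (λ x → (x , py) , 2F) (i-1≤j<i⇒i≡j+1 (ℤ.≮⇒≥ px≮ux-1) px<ux)
  crossing⇒start {ux , uy} {3F} _ c with crossesRay⇒ {p = top} {u = ux , uy} c
  ... | inj₁ (refl , e , _) = ⊥-elim (ℤ.<⇒≢ (i<i+1 py) e)
  ... | inj₂ (e , refl , _) = ⊥-elim (ℤ.<⇒≢ (i<i+1 py) (sym e))
  crossing⇒start {ux , uy} {4F} (left , _) c with crossesRay⇒ {p = top} {u = ux , uy} c
  ... | inj₁ (refl , e , _) = ⊥-elim (i-1≢i+1 py e)
  ... | inj₂ (e , refl , px<ux) =
    ⊥-elim (Bool.not-¬ (trans (cong (λ y → S (ux + + 1 , y)) (sym e)) left)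
                       (nothing-right (ℤ.<-trans px<ux (i<i+1 ux))))
  crossing⇒start {ux , uy} {5F} (left , _) c with crossesRay⇒ {p = top} {u = ux , uy} c
  ... | inj₁ (refl , e , _) = ⊥-elim (i-1≢i+1 py e)
  ... | inj₂ (_ , refl , _) = ⊥-elim (Bool.not-¬ left (nothing-above (i<i+1 py)))

  darts : List Dart
  darts = cartesianProduct (cartesianProductWith move L (allFin 6)) (allFin 6)

  boundary⊆darts : ∀ {d} → IsBoundaryDart S d → d ∈ darts
  boundary⊆darts {u , k} (left , _) = ∈-cartesianProduct⁺
    (subst (_∈ _) (move-back u (rot 1 k)) (∈-cartesianProductWith⁺ move (S⊆L left) (∈-allFin _)))
    (∈-allFin k)

  next-injective : ∀ {d e} → IsBoundaryDart S d → IsBoundaryDart S e → next d ≡ next e → d ≡ e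
  next-injective bd be eq =
    trans (sym (proj₂ (next-spec bd))) (trans (cong previous eq) (proj₂ (next-spec be)))

  _≟ᴰ_ : DecidableEquality Dart
  _≟ᴰ_ = Product.≡-dec _≟ᴾ_ Fin._≟_

  trajectory : ℕ → Dart
  trajectory = orbit next start

  trajectory-boundary : ∀ t → IsBoundaryDart S (trajectory t)
  trajectory-boundary =
    orbit-closed next (IsBoundaryDart S) (proj₁ ∘ next-spec) next-injective start-boundary

  firstReturn : ∃[ m ] trajectory (suc m) ≡ start × (∀ {t} → t ℕ.< m → trajectory (suc t) ≢ start)
  firstReturn = orbit-firstReturn next (IsBoundaryDart S) (proj₁ ∘ next-spec) next-injective
                  start-boundary _≟ᴰ_ darts boundary⊆darts

  period : ℕ
  period = proj₁ firstReturn

  vertex : ℕ → Pt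
  vertex t = proj₁ (trajectory t)

  edge : ℕ → Pt × Pt
  edge t = vertex t , vertex (suc t)

  walk : List Pt
  walk = applyUpTo vertex (suc period)

  cycEdges-walk : cycEdges walk ≡ applyUpTo edge (suc period)
  cycEdges-walk = begin
    zip walk (applyUpTo (vertex ∘ suc) period ++ [ vertex 0 ])
      ≡⟨ cong (λ d → zip walk (applyUpTo (vertex ∘ suc) period ++ [ proj₁ d ])) (proj₁ (proj₂ firstReturn)) ⟨
    zip walk (applyUpTo (vertex ∘ suc) period ++ [ vertex (suc period) ])
      ≡⟨ cong (zip walk) (applyUpTo-∷ʳ (vertex ∘ suc) period) ⟩
    zip walk (applyUpTo (vertex ∘ suc) (suc period))
      ≡⟨ zip-applyUpTo vertex (vertex ∘ suc) (suc period) ⟩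
    applyUpTo edge (suc period) ∎
    where open ≡-Reasoning

  walk-hugs : All (λ u → S u ≡ false × Σ Dir λ k → S (move u k) ≡ true) walk
  walk-hugs = All.applyUpTo⁺₂ vertex (suc period) λ t →
    let left , out , _ = trajectory-boundary t in out , rot 1 (proj₂ (trajectory t)) , left

  walk-closed : ClosedWalk walk
  walk-closed = subst ClosedEdges (sym cycEdges-walk)
    (All.applyUpTo⁺₂ edge (suc period) λ t → move-adj (vertex t) (proj₂ (trajectory t)))

  walk-once : crossings top walk ≡ 1
  walk-once = begin
    rayCrossings top (cycEdges walk)                           ≡⟨ cong (rayCrossings top) cycEdges-walk ⟩
    rayCrossings top (edge 0 ∷ applyUpTo (edge ∘ suc) period)
      ≡⟨ cong length (filter-accept crosses? {edge 0} {applyUpTo (edge ∘ suc) period}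
           (crossesRay⇐ {top} {vertex 0} {vertex 1} refl refl (i<i+1 px))) ⟩
    suc (rayCrossings top (applyUpTo (edge ∘ suc) period))
      ≡⟨ cong (suc ∘ length) (filter-none crosses? (All.applyUpTo⁺₁ (edge ∘ suc) period λ {t} t<m c →
           proj₂ (proj₂ firstReturn) t<m (crossing⇒start (trajectory-boundary (suc t)) c))) ⟩
    1                                                          ∎
    where
    open ≡-Reasoning
    crosses? : ∀ e → Dec (crossesRay top e ≡ true)
    crosses? e = crossesRay top e Bool.≟ true

isYes⇒ : ∀ {A : Set} (a? : Dec A) → ⌊ a? ⌋ ≡ true → A
isYes⇒ a? = toWitness ∘ Equivalence.from Bool.T-≡

⇒isYes : ∀ {A : Set} (a? : Dec A) → A → ⌊ a? ⌋ ≡ true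
⇒isYes a? = Equivalence.to Bool.T-≡ ∘ fromWitness

record Surrounds (S : Pt → Set) (p : Pt) (ws : List Pt) : Set where
  field
    hugs   : All (λ u → ¬ S u × Σ Dir λ k → S (move u k)) ws
    closed : ClosedWalk ws
    once   : crossings p ws ≡ 1

opaque
  surroundingWalk : ∀ {S : Pt → Set} → Decidable S → (L : List Pt) → (∀ {v} → S v → v ∈ L) →
                    ∀ {s₀} → S s₀ → ∃[ p ] S p × ∃[ ws ] Surrounds S p ws
  surroundingWalk {S} S? L S⊆L Ss₀ =
    let top , top-highest = highest inS L (S⊆L ∘ isYes⇒ (S? _)) (⇒isYes (S? _) Ss₀)
        open Tracing inS L (S⊆L ∘ isYes⇒ (S? _)) top top-highest
    in top , isYes⇒ (S? top) (IsHighest.member top-highest) , walk , record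
      { hugs   = All.map (λ (out , k , in′) → (Bool.not-¬ out ∘ ⇒isYes (S? _)) , k , isYes⇒ (S? _) in′)
                         walk-hugs
      ; closed = walk-closed
      ; once   = walk-once
      }
    where
    inS : Pt → Bool
    inS v = ⌊ S? v ⌋

inT? : ∀ T → Decidable (InT T)
inT? (triangle a b n true)  (x , y) = a ℤ.≤? x ×-dec b ℤ.≤? y ×-dec (x - a) + (y - b) ℤ.≤? + n
inT? (triangle a b n false) (x , y) = x ℤ.≤? a ×-dec y ℤ.≤? b ×-dec (a - x) + (b - y) ℤ.≤? + n

district? : ∀ T d i → Decidable (District T d i)
district? T d i v = inT? T v ×-dec d v Fin.≟ i

span : ℤ → ℕ → List ℤ
span c n = applyUpTo (λ m → c + + m) (suc n) ++ applyUpTo (λ m → c - + m) (suc n)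

∈-span-above : ∀ {c z n} → c ℤ.≤ z → z - c ℤ.≤ + n → z ∈ span c n
∈-span-above {c} {z} {n} c≤z z-c≤n =
  ∈-++⁺ˡ (subst (_∈ _) (trans (cong (λ t → c + t) dist) (c+[z-c] c z))
  (∈-applyUpTo⁺ (λ m → c + + m) (s≤s (ℤ.drop‿+≤+ (subst (ℤ._≤ + n) (sym dist) z-c≤n)))))
  where
  dist : + ∣ z - c ∣ ≡ z - c
  dist = ℤ.0≤i⇒+∣i∣≡i (ℤ.i≤j⇒0≤j-i c≤z)
  c+[z-c] : ∀ c z → c + (z - c) ≡ z
  c+[z-c] = solve-∀

∈-span-below : ∀ {c z n} → z ℤ.≤ c → c - z ℤ.≤ + n → z ∈ span c n
∈-span-below {c} {z} {n} z≤c c-z≤n =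
  ∈-++⁺ʳ (applyUpTo (λ m → c + + m) (suc n)) (subst (_∈ _) (trans (cong (λ t → c - t) dist) (c-[c-z] c z))
  (∈-applyUpTo⁺ (λ m → c - + m) (s≤s (ℤ.drop‿+≤+ (subst (ℤ._≤ + n) (sym dist) c-z≤n)))))
  where
  dist : + ∣ c - z ∣ ≡ c - z
  dist = ℤ.0≤i⇒+∣i∣≡i (ℤ.i≤j⇒0≤j-i z≤c)
  c-[c-z] : ∀ c z → c - (c - z) ≡ z
  c-[c-z] = solve-∀

vertices : Triangle → List Pt
vertices (triangle a b n _) = cartesianProduct (span a n) (span b n)

InT⇒∈vertices : ∀ T {v} → InT T v → v ∈ vertices T
InT⇒∈vertices (triangle a b n true) (a≤x , b≤y , sum≤n) = ∈-cartesianProduct⁺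
  (∈-span-above a≤x (ℤ.≤-trans (i≤i+j (ℤ.i≤j⇒0≤j-i b≤y)) sum≤n))
  (∈-span-above b≤y (ℤ.≤-trans (i≤j+i (ℤ.i≤j⇒0≤j-i a≤x)) sum≤n))
InT⇒∈vertices (triangle a b n false) (x≤a , y≤b , sum≤n) = ∈-cartesianProduct⁺
  (∈-span-below x≤a (ℤ.≤-trans (i≤i+j (ℤ.i≤j⇒0≤j-i y≤b)) sum≤n))
  (∈-span-below y≤b (ℤ.≤-trans (i≤j+i (ℤ.i≤j⇒0≤j-i x≤a)) sum≤n))

adjacent? : ∀ {A B : Pt → Set} → Decidable A → Decidable B → (L : List Pt) → (∀ {v} → A v → v ∈ L) →
            Dec (AdjacentSets A B)
adjacent? {A} {B} A? B? L A⊆L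
  with any? (λ (s , k) → A? s ×-dec B? (move s k)) (cartesianProduct L (allFin 6))
... | yes found with (s , k) , As , Bt ← satisfied found = yes (s , move s k , As , Bt , move-adj s k)
... | no none = no λ (u , v , Au , Bv , u~v) → refute u~v Au Bv
  where
  refute : ∀ {u v} → Adj u v → A u → ¬ B v
  refute {u} u~v Au Bv with k , refl ← adj⇒move u~v =
    none (lose (∈-cartesianProduct⁺ (A⊆L Au) (∈-allFin k)) (Au , Bv))

third : ∀ {i j : Fin 3} → j ≢ i → ∃[ k ] k ≢ i × (∀ l → l ≢ i → l ≢ j → l ≡ k)
third {0F} {0F} j≢i = ⊥-elim (j≢i refl)
third {1F} {1F} j≢i = ⊥-elim (j≢i refl)
third {2F} {2F} j≢i = ⊥-elim (j≢i refl)
third {0F} {1F} _ = 2F , (λ ()) ,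
  λ { 0F ≢i _ → ⊥-elim (≢i refl) ; 1F _ ≢j → ⊥-elim (≢j refl) ; 2F _ _ → refl }
third {0F} {2F} _ = 1F , (λ ()) ,
  λ { 0F ≢i _ → ⊥-elim (≢i refl) ; 1F _ _ → refl ; 2F _ ≢j → ⊥-elim (≢j refl) }
third {1F} {0F} _ = 2F , (λ ()) ,
  λ { 0F _ ≢j → ⊥-elim (≢j refl) ; 1F ≢i _ → ⊥-elim (≢i refl) ; 2F _ _ → refl }
third {1F} {2F} _ = 0F , (λ ()) ,
  λ { 0F _ _ → refl ; 1F ≢i _ → ⊥-elim (≢i refl) ; 2F _ ≢j → ⊥-elim (≢j refl) }
third {2F} {0F} _ = 1F , (λ ()) ,
  λ { 0F _ ≢j → ⊥-elim (≢j refl) ; 1F _ _ → refl ; 2F ≢i _ → ⊥-elim (≢i refl) }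
third {2F} {1F} _ = 0F , (λ ()) ,
  λ { 0F _ _ → refl ; 1F _ ≢j → ⊥-elim (≢j refl) ; 2F ≢i _ → ⊥-elim (≢i refl) }

neighbour-of-interior : ∀ T d {i j k} → (∀ v → District T d i v → ¬ Bd T v) →
  ¬ AdjacentSets (District T d i) (District T d j) → (∀ l → l ≢ i → l ≢ j → l ≡ k) →
  ∀ {s u} → District T d i s → Adj s u → ¬ District T d i u → District T d k u
neighbour-of-interior T d interior ¬adj only-k {s} {u} Ps s~u u∉Pi with inT? T u
... | no u∉T = ⊥-elim (interior s Ps (proj₁ Ps , u , s~u , u∉T))
... | yes u∈T =
  u∈T , only-k (d u) (λ du≡i → u∉Pi (u∈T , du≡i)) (λ du≡j → ¬adj (s , u , Ps , (u∈T , du≡j) , s~u))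

lemma28 : (T : Triangle) (d : Pt → Fin 3) → IsPartition T d →
          (i : Fin 3) → (∀ v → District T d i v → ¬ Bd T v) →
          (j : Fin 3) → j ≢ i → AdjacentSets (District T d i) (District T d j)
lemma28 T d part i interior j j≢i =
  decidable-stable (adjacent? (district? T d i) (district? T d j) (vertices T) (InT⇒∈vertices T ∘ proj₁))
  λ ¬adj →
  let (s₀ , s₀∈Pᵢ) , _ = part i
      p , p∈Pᵢ , ws , walk = surroundingWalk (district? T d i) (vertices T) (InT⇒∈vertices T ∘ proj₁) s₀∈Pᵢ
      open Surrounds walk
      k , k≢i , only-k = third j≢i
      p∉Pₖ : ¬ District T d k p
      p∉Pₖ (_ , dp≡k) = k≢i (trans (sym dp≡k) (proj₂ p∈Pᵢ))
      ws⊆Pₖ : All (District T d k) ws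
      ws⊆Pₖ = All.map (λ (u∉Pᵢ , k′ , u+k′∈Pᵢ) →
                neighbour-of-interior T d interior ¬adj only-k u+k′∈Pᵢ (move-adj⁻ _ k′) u∉Pᵢ) hugs
      vs , cycle , vs⊆Pₖ , encloses =
        oddWalk⇒enclosingCycle (District T d k) p∉Pₖ ws ws⊆Pₖ closed (cong (ℕ._% 2) once)
  in p∉Pₖ (proj₂ (proj₂ (part k)) vs cycle vs⊆Pₖ p encloses)
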